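{- Let $G$ be a game, $\sigma$ a skeleton on $G$ and $g$ a strategy on $G$ such that $\sigma$ implements $g$. Then for all $smn\in g$, $\tilde s\in\sigma$ and $\tilde s\tilde m\in P_G$ with $sm\simeq_G\tilde s\tilde m$, there exists $\tilde s\tilde m\tilde n\in\sigma$ with $smn\simeq_G\tilde s\tilde m\tilde n$.
   Context: A move is a triple $(m,x,y)$ with $x\in\{O,P\}$ (O-move/P-move) and $y\in\{Q,A\}$ (question/answer). A justified (j-)sequence is a finite sequence $s=s(1)\cdots s(|s|)$ of moves with a map $\mathcal J_s:\{1,\dots,|s|\}\to\{0,\dots,|s|-1\}$, $\mathcal J_s(i)<i$; if $\mathcal J_s(i)=0$ the occurrence $s(i)$ is initial, otherwise it is justified by $s(\mathcal J_s(i))$. J-sequences are equal iff they have the same moves and pointers; prefixes inherit pointers; $sm$ denotes extension by one move (with a pointer). $X^{\mathrm{Even}}$ denotes the even-length elements of a set $X$ of j-sequences. The P-view $\lceil s\rceil$ and O-view $\lfloor s\rfloor$ are the j-subsequences given by: $\lceil\epsilon\rceil=\epsilon$; $\lceil sm\rceil=\lceil s\rceil m$ if $m$ is a P-move; $\lceil sm\rceil=m$ if $m$ is initial; $\lceil smtn\rceil=\lceil s\rceil mn$ if $n$ is an O-move justified by $m$; $\lfloor\epsilon\rfloor=\epsilon$; $\lfloor sm\rfloor=\lfloor s\rfloor m$ if $m$ is an O-move; $\lfloor smtn\rfloor=\lfloor s\rfloor mn$ if $n$ is a P-move justified by $m$. A legal position is a j-sequence in which consecutive moves have distinct O/P labels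 and such that whenever $s=tmu$ with $m$ non-initial, the justifier of $m$ occurs in $\lceil t\rceil$ if $m$ is a P-move and in $\lfloor t\rfloor$ otherwise. A game is a pair $G=(P_G,\simeq_G)$ where $P_G$ is a non-empty prefix-closed set of legal positions and $\simeq_G$ is an equivalence relation on $P_G$ satisfying (I1) $s\simeq_G t\Rightarrow|s|=|t|$; (I2) $sm\simeq_G tn\Rightarrow s\simeq_G t$, $m,n$ carry the same labels and $\mathcal J_{sm}(|sm|)=\mathcal J_{tn}(|tn|)$; (I3) $s\simeq_G t\wedge sm\in P_G\Rightarrow\exists tn\in P_G.\ sm\simeq_G tn$; moreover the induced arena (moves occurring in $P_G$, with $\star\vdash_G m$ iff $m$ occurs initially and $m\vdash_G n$ iff $n$ occurs justified by $m$) satisfies: initial moves are O-questions, answers are enabled only by questions, non-$\star$ enabling flips the O/P label, and there is no infinite chain $\star\vdash_G m_0\vdash_G m_1\vdash_G\cdots$. A skeleton on $G$ is a non-empty, even-prefix-closed, deterministic ($smn,smn'\in\sigma\Rightarrow smn=smn'$) set $\sigma\subseteq P_G^{\mathrm{Even}}$. A strategy on $G$ is a set $g\subseteq P_G^{\mathrm{Even}}$ that is non-empty, even-prefix-closed, satisfies $smn,tlr\in g\wedge sm\simeq_G tl\Rightarrow smn\simeq_G tlr$, and satisfies $s\in g\wedge t\in P_G\wedge s\simeq_G t\Rightarrow t\in g$. A skeleton $\sigma$ implements a strategy $g$ if $\sigma\subseteq g$ and for all $smn\in g$ with $s\in\sigma$ there is $smn'\in\sigma$ with $smn\simeq_G smn'$.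 -}

module Defs where

open import Data.Nat using (ℕ; zero; suc; _≤_; _∸_)
open import Data.Bool using (Bool; true; false; if_then_else_)
open import Data.List using (List; []; _∷_; _++_; length; take; [_])
open import Data.List.Membership.Propositional using (_∈_)
open import Data.Maybe using (Maybe; just; nothing)
open import Data.Product using (Σ; ∃; ∃-syntax; _×_; _,_)
open import Relation.Binary.PropositionalEquality using (_≡_; _≢_)
open import Relation.Nullary using (¬_)

data OP : Set where
  O P : OP

data QA : Set where
  Q A : QA

record Move (M : Set) : Set where
  constructor mv
  field
    name : M
    pol  : OP
    kind : QA
open Move public

-- A (candidate) justified sequence is a list of occurrences (move , pointer);
-- positions are 1-based, pointer 0 means "initial", pointer j > 0 means
-- "justified by the occurrence at position j".  Equality of j-sequences is
-- propositional equality (same moves and same pointers); the prefix of a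
-- j-sequence inherits the pointers; s m is  s ++ [ (m , j) ].

Occ : Set → Set
Occ M = Move M × ℕ

JSeqList : Set → Set
JSeqList M = List (Occ M)

-- the side condition J_s(i) < i
IsJSeq : {M : Set} → JSeqList M → Set
IsJSeq s = ∀ t m p u → s ≡ t ++ (m , p) ∷ u → p ≤ length t

data Even : ℕ → Set where
  even-zero : Even zero
  even-ss   : ∀ {n} → Even n → Even (suc (suc n))

-- Views, computed as the list of positions (1-based) of the occurrences
-- of s that belong to the view (a j-subsequence is determined by these).

at : {A : Set} → List A → ℕ → Maybe A
at [] _ = nothing
at (x ∷ xs) zero = just x
at (x ∷ xs) (suc i) = at xs i

-- pvF f s k : P-view of the prefix of length k of s (fuel f ≥ k).
-- Clauses:  ⌈ s m ⌉ = ⌈ s ⌉ m  (m a P-move);  ⌈ s m ⌉ = m  (m initial);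
--           ⌈ s m t n ⌉ = ⌈ s ⌉ m n  (n an O-move justified by m).
pvF : {M : Set} → ℕ → JSeqList M → ℕ → List ℕ
pvF zero s k = []
pvF (suc f) s zero = []
pvF (suc f) s (suc k) with at s k
... | nothing = []
... | just (m , p) with pol m | p
...   | P | _ = pvF f s k ++ [ suc k ]
...   | O | zero = [ suc k ]
...   | O | suc j = pvF f s j ++ (suc j ∷ suc k ∷ [])

-- ovF f s k : O-view of the prefix of length k of s.
-- Clauses:  ⌊ s m ⌋ = ⌊ s ⌋ m  (m an O-move);
--           ⌊ s m t n ⌋ = ⌊ s ⌋ m n  (n a P-move justified by m).
-- (For an initial P-move, not covered by the paper's clauses and never
--  occurring in a game, we use the convention ⌊ s m ⌋ = m.)
ovF : {M : Set} → ℕ → JSeqList M → ℕ → List ℕ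
ovF zero s k = []
ovF (suc f) s zero = []
ovF (suc f) s (suc k) with at s k
... | nothing = []
... | just (m , p) with pol m | p
...   | O | _ = ovF f s k ++ [ suc k ]
...   | P | zero = [ suc k ]
...   | P | suc j = ovF f s j ++ (suc j ∷ suc k ∷ [])

pview : {M : Set} → JSeqList M → List ℕ
pview s = pvF (length s) s (length s)

oview : {M : Set} → JSeqList M → List ℕ
oview s = ovF (length s) s (length s)

viewFor : {M : Set} → OP → JSeqList M → List ℕ
viewFor P t = pview t
viewFor O t = oview t

Alternating : {M : Set} → JSeqList M → Set
Alternating s = ∀ t m p n q u → s ≡ t ++ (m , p) ∷ (n , q) ∷ u → pol m ≢ pol n

Visible : {M : Set} → JSeqList M → Set
Visible s = ∀ t m p u → s ≡ t ++ (m , p) ∷ u → p ≢ 0 → p ∈ viewFor (pol m) t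

Legal : {M : Set} → JSeqList M → Set
Legal s = IsJSeq s × Alternating s × Visible s

InitialIn : {M : Set} → (JSeqList M → Set) → Move M → Set
InitialIn {M} Pos m = Σ (JSeqList M) λ s → Pos s × ∃[ t ] ∃[ u ] (s ≡ t ++ (m , 0) ∷ u)

EnablesIn : {M : Set} → (JSeqList M → Set) → Move M → Move M → Set
EnablesIn {M} Pos m n = Σ (JSeqList M) λ s → Pos s ×
  ∃[ t ] ∃[ j ] ∃[ u ] ∃[ q ] (s ≡ t ++ (n , suc j) ∷ u × at t j ≡ just (m , q))

record Game (M : Set) : Set₁ where
  field
    Pos : JSeqList M → Set
    _≃_ : JSeqList M → JSeqList M → Set
    nonempty     : ∃[ s ] Pos s
    prefixClosed : ∀ s t → Pos (s ++ t) → Pos s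
    legal        : ∀ s → Pos s → Legal s
    ≃-dom   : ∀ s t → s ≃ t → Pos s × Pos t
    ≃-refl  : ∀ s → Pos s → s ≃ s
    ≃-sym   : ∀ s t → s ≃ t → t ≃ s
    ≃-trans : ∀ s t u → s ≃ t → t ≃ u → s ≃ u
    I1 : ∀ s t → s ≃ t → length s ≡ length t
    I2 : ∀ s t m n p q → (s ++ [ (m , p) ]) ≃ (t ++ [ (n , q) ]) →
         s ≃ t × pol m ≡ pol n × kind m ≡ kind n × p ≡ q
    I3 : ∀ s t m p → s ≃ t → Pos (s ++ [ (m , p) ]) →
         ∃[ n ] ∃[ q ] (Pos (t ++ [ (n , q) ]) × (s ++ [ (m , p) ]) ≃ (t ++ [ (n , q) ]))
    initial-OQ   : ∀ m → InitialIn Pos m → pol m ≡ O × kind m ≡ Q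
    answer-by-Q  : ∀ m n → EnablesIn Pos m n → kind n ≡ A → kind m ≡ Q
    enable-flips : ∀ m n → EnablesIn Pos m n → pol m ≢ pol n
    no-inf-chain : ¬ (Σ (ℕ → Move M) λ f →
                      InitialIn Pos (f 0) × (∀ i → EnablesIn Pos (f i) (f (suc i))))

module _ {M : Set} (G : Game M) where
  open Game G

  EvenPrefixClosedSub : (JSeqList M → Set) → Set
  EvenPrefixClosedSub X =
    (∀ s → X s → Pos s × Even (length s)) ×
    (∃[ s ] X s) ×
    (∀ s t → X (s ++ t) → Even (length s) → X s)

  Skeleton : (JSeqList M → Set) → Set
  Skeleton σ = EvenPrefixClosedSub σ ×
    (∀ s m n n′ → σ (s ++ m ∷ n ∷ []) → σ (s ++ m ∷ n′ ∷ []) →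
       (s ++ m ∷ n ∷ []) ≡ (s ++ m ∷ n′ ∷ []))

  Strategy : (JSeqList M → Set) → Set
  Strategy g = EvenPrefixClosedSub g ×
    (∀ s m n t l r → g (s ++ m ∷ n ∷ []) → g (t ++ l ∷ r ∷ []) →
       (s ++ [ m ]) ≃ (t ++ [ l ]) → (s ++ m ∷ n ∷ []) ≃ (t ++ l ∷ r ∷ [])) ×
    (∀ s t → g s → Pos t → s ≃ t → g t)

  Implements : (JSeqList M → Set) → (JSeqList M → Set) → Set
  Implements σ g = (∀ s → σ s → g s) ×
    (∀ s m n → g (s ++ m ∷ n ∷ []) → σ s →
       ∃[ n′ ] (σ (s ++ m ∷ n′ ∷ []) × (s ++ m ∷ n ∷ []) ≃ (s ++ m ∷ n′ ∷ [])))

module Submission where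

open import Defs
open import Data.List using ([]; _∷_; _++_; [_])
open import Data.List.Properties using (++-assoc)
open import Data.Product using (_×_; ∃-syntax; _,_; proj₁; proj₂)
open import Relation.Binary.PropositionalEquality using (_≡_; subst; subst₂; sym)

-- Transport the given response along sm ≃ s̃m̃ by (I3), pull the result into g
-- by ≃-closure, and let the skeleton answer for it; transitivity finishes.

module _ {M : Set} (G : Game M) where
  open Game G

  snoc-snoc : (s : JSeqList M) (m n : Occ M) → (s ++ [ m ]) ++ [ n ] ≡ s ++ m ∷ n ∷ []
  snoc-snoc s m n = ++-assoc s [ m ] [ n ]

  ≃-extendResponse : ∀ s m n t l → (s ++ [ m ]) ≃ (t ++ [ l ]) → Pos (s ++ m ∷ n ∷ []) →
    ∃[ r ] ((s ++ m ∷ n ∷ []) ≃ (t ++ l ∷ r ∷ []))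
  ≃-extendResponse s m (n , p) t l sm≃tl smn∈P
    with I3 (s ++ [ m ]) (t ++ [ l ]) n p sm≃tl (subst Pos (sym (snoc-snoc s m (n , p))) smn∈P)
  ... | n′ , p′ , _ , smn≃tln′ =
    (n′ , p′) , subst₂ _≃_ (snoc-snoc s m (n , p)) (snoc-snoc t l (n′ , p′)) smn≃tln′

  strategy⊆Pos : ∀ {g} → Strategy G g → ∀ {s} → g s → Pos s
  strategy⊆Pos (sub , _) {s} gs = proj₁ (proj₁ sub s gs)

  strategy-resp-≃ : ∀ {g} → Strategy G g → ∀ {s t} → g s → s ≃ t → g t
  strategy-resp-≃ (_ , _ , closed) {s} {t} gs s≃t = closed s t gs (proj₂ (≃-dom s t s≃t)) s≃t

mainTheorem2 : {M : Set} (G : Game M) (σ g : JSeqList M → Set) →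
    Skeleton G σ → Strategy G g → Implements G σ g →
    ∀ s m n s̃ m̃ →
    g (s ++ m ∷ n ∷ []) → σ s̃ → Game.Pos G (s̃ ++ [ m̃ ]) →
    Game._≃_ G (s ++ [ m ]) (s̃ ++ [ m̃ ]) →
    ∃[ ñ ] (σ (s̃ ++ m̃ ∷ ñ ∷ []) × Game._≃_ G (s ++ m ∷ n ∷ []) (s̃ ++ m̃ ∷ ñ ∷ []))
mainTheorem2 G σ g _ gStrat (_ , σ-answers) s m n s̃ m̃ smn∈g s̃∈σ _ sm≃s̃m̃
  with ≃-extendResponse G s m n s̃ m̃ sm≃s̃m̃ (strategy⊆Pos G gStrat smn∈g)
... | n₀ , smn≃s̃m̃n₀
  with σ-answers s̃ m̃ n₀ (strategy-resp-≃ G gStrat smn∈g smn≃s̃m̃n₀) s̃∈σ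
... | ñ , s̃m̃ñ∈σ , s̃m̃n₀≃s̃m̃ñ = ñ , s̃m̃ñ∈σ , Game.≃-trans G _ _ _ smn≃s̃m̃n₀ s̃m̃n₀≃s̃m̃ñ
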